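{- Let $G$ be a finite, simple, connected graph and let $x_0,x_1,x_2,x_3$ be vertices of $G$ inducing the 4-cycle $x_0x_1x_2x_3$ and forming a module (every other vertex of $G$ is adjacent to all of them or to none of them). If $G-x_0$ satisfies property (P), then $G$ also satisfies property (P), where a graph $H$ on $m$ vertices satisfies (P) if either $H$ has two distinct vertices $u,v$ with $d_H(u,v)\le 2$ and $\overline{uv}=V(H)$, or $H$ has at least $m$ distinct lines.
   Context: $d_H$ is the shortest-path distance in $H$. A vertex $z$ is between $u$ and $v$ if $d_H(u,v)=d_H(u,z)+d_H(z,v)$. For distinct vertices $u,v$, the line $\overline{uv}$ (in $H$) is the set of all vertices $z$ such that one of $u,v,z$ is between the other two. -}

module Defs where

open import Data.Nat using (ℕ; zero; suc; _+_; _≤_)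
open import Data.Fin using (Fin; punchIn)
open import Data.Product using (Σ; ∃; _×_; _,_; proj₁; proj₂)
open import Data.Sum using (_⊎_)
open import Relation.Nullary using (¬_; Dec)
open import Relation.Binary.PropositionalEquality using (_≡_; _≢_)
open import Function.Bundles using (_⇔_)

record Graph (n : ℕ) : Set₁ where
  field
    Adj   : Fin n → Fin n → Set
    adj?  : ∀ u v → Dec (Adj u v)
    sym   : ∀ {u v} → Adj u v → Adj v u
    irrefl : ∀ {u} → ¬ Adj u u
open Graph public

data Walk {n : ℕ} (H : Graph n) : Fin n → Fin n → ℕ → Set where
  nil  : ∀ {u} → Walk H u u 0
  cons : ∀ {u w v k} → Adj H u w → Walk H w v k → Walk H u v (suc k)

Connected : ∀ {n} → Graph n → Set
Connected H = ∀ u v → ∃ λ k → Walk H u v k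

Dist : ∀ {n} → Graph n → Fin n → Fin n → ℕ → Set
Dist H u v k = Walk H u v k × (∀ j → Walk H u v j → k ≤ j)

Between : ∀ {n} → Graph n → Fin n → Fin n → Fin n → Set
Between H u v z = Σ ℕ λ a → Σ ℕ λ b → Σ ℕ λ c →
  Dist H u v a × Dist H u z b × Dist H z v c × a ≡ b + c

OnLine : ∀ {n} → Graph n → Fin n → Fin n → Fin n → Set
OnLine H u v z = Between H u v z ⊎ Between H u z v ⊎ Between H z v u

-- two lines (given by their defining pairs) are equal as vertex sets
SameLine : ∀ {n} → Graph n → Fin n × Fin n → Fin n × Fin n → Set
SameLine H (u , v) (u' , v') = ∀ z → (OnLine H u v z ⇔ OnLine H u' v' z)

PropertyP : ∀ {m} → Graph m → Set
PropertyP {m} H =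
  (Σ (Fin m) λ u → Σ (Fin m) λ v → u ≢ v ×
     (Σ ℕ λ k → k ≤ 2 × Dist H u v k) × (∀ z → OnLine H u v z))
  ⊎
  (Σ (Fin m → Fin m × Fin m) λ f →
     (∀ i → proj₁ (f i) ≢ proj₂ (f i)) ×
     (∀ i j → i ≢ j → ¬ SameLine H (f i) (f j)))

-- G - x : the induced subgraph on all vertices other than x
-- (vertices of G - x are Fin n, embedded into Fin (suc n) by punchIn x)
deleteVertex : ∀ {n} → Graph (suc n) → Fin (suc n) → Graph n
deleteVertex G x = record
  { Adj = λ u v → Adj G (punchIn x u) (punchIn x v)
  ; adj? = λ u v → adj? G (punchIn x u) (punchIn x v)
  ; sym = sym G
  ; irrefl = irrefl G
  }

InducedC4 : ∀ {n} → Graph n → Fin n → Fin n → Fin n → Fin n → Set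
InducedC4 G x0 x1 x2 x3 =
  (x0 ≢ x1 × x0 ≢ x2 × x0 ≢ x3 × x1 ≢ x2 × x1 ≢ x3 × x2 ≢ x3) ×
  (Adj G x0 x1 × Adj G x1 x2 × Adj G x2 x3 × Adj G x3 x0) ×
  (¬ Adj G x0 x2 × ¬ Adj G x1 x3)

IsModule4 : ∀ {n} → Graph n → Fin n → Fin n → Fin n → Fin n → Set
IsModule4 G x0 x1 x2 x3 = ∀ y → y ≢ x0 → y ≢ x1 → y ≢ x2 → y ≢ x3 →
  (Adj G y x0 × Adj G y x1 × Adj G y x2 × Adj G y x3) ⊎
  (¬ Adj G y x0 × ¬ Adj G y x1 × ¬ Adj G y x2 × ¬ Adj G y x3)

module Submission where

-- Write M = {x0, x1, x2, x3} and G' = G - x0.  Inside the module, x0 and x2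
-- are false twins (equal open neighbourhoods), so G' embeds isometrically in
-- G via punchIn x0, and lines of G' are exactly the traces of lines of G.
-- Two facts about lines then drive the proof:
--   * a vertex q equidistant with p from v, at positive distance from p that
--     is not twice d(p,v), is not on the line pv (used for x1 on x2v with v
--     outside M, and for x2 on x0y with y not adjacent to x0);
--   * for u, v outside {x0, x2}, x0 is on uv iff x2 is.
-- If G' has a spanning pair u, v, the lifted pair spans G as well (x0 is
-- recovered from x2, or directly when x2 is an endpoint).  If G' has n
-- distinct lines, either some y ∉ {x0, x2} is not adjacent to x0, and the
-- line x0y (which misses x2) is new among the lifted lines; or x0 is adjacent
-- to every such y, and then x1, x3 is a spanning pair of G.

open import Defs
open import Data.Nat using (ℕ; zero; suc; _+_; _≤_; _<_; z≤n; s≤s)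
open import Data.Nat.Properties
  using (≤-antisym; ≤-trans; ≤-refl; ≮⇒≥; +-identityʳ; +-suc; +-comm; n≤1+n;
         m≢1+n+m; m<1+n⇒m<n∨m≡n)
open import Data.Fin using (Fin; punchIn; punchOut) renaming (zero to fzero; suc to fsuc)
open import Data.Fin.Properties using (_≟_; any?; punchIn-punchOut; punchInᵢ≢i; punchIn-injective)
open import Data.Product using (Σ; ∃; _×_; _,_; proj₁; proj₂)
open import Data.Sum using (_⊎_; inj₁; inj₂)
open import Data.Empty using (⊥-elim)
open import Relation.Nullary using (¬_; Dec; yes; no)
open import Relation.Nullary.Decidable using (¬?; _×-dec_; _⊎-dec_)
open import Relation.Binary.PropositionalEquality
  using (_≡_; _≢_; refl; cong; cong₂; subst; subst₂; trans) renaming (sym to ≡-sym)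
open import Function.Bundles using (_⇔_; mk⇔; Equivalence)

-- Least number principle for decidable predicates: a witness yields a least
-- witness.  This is what makes distances exist in a finite graph.
least-witness : ∀ {P : ℕ → Set} → (∀ k → Dec (P k)) →
  ∀ {k} → P k → ∃ λ m → P m × (∀ j → P j → m ≤ j)
least-witness {P} P? {k} p = search 0 k (λ _ ()) p
  where
  search : ∀ i r → (∀ j → j < i → ¬ P j) → P (i + r) →
    ∃ λ m → P m × (∀ j → P j → m ≤ j)
  search i r below p with P? i
  ... | yes pᵢ = i , pᵢ , λ j pⱼ → ≮⇒≥ (λ j<i → below j j<i pⱼ)
  search i zero below p | no ¬pᵢ = ⊥-elim (¬pᵢ (subst P (+-identityʳ i) p))
  search i (suc r) below p | no ¬pᵢ = search (suc i) r below′ (subst P (+-suc i r) p)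
    where
    below′ : ∀ j → j < suc i → ¬ P j
    below′ j j<1+i with m<1+n⇒m<n∨m≡n j<1+i
    ... | inj₁ j<i = below j j<i
    ... | inj₂ refl = ¬pᵢ

module _ {m : ℕ} {H : Graph m} where

  snoc : ∀ {u v w k} → Walk H u v k → Adj H v w → Walk H u w (suc k)
  snoc nil e = cons e nil
  snoc (cons e′ r) e = cons e′ (snoc r e)

  reverse : ∀ {u v k} → Walk H u v k → Walk H v u k
  reverse nil = nil
  reverse (cons e r) = snoc (reverse r) (sym H e)

  walk-0 : ∀ {u v} → Walk H u v 0 → u ≡ v
  walk-0 nil = refl

  walk-1 : ∀ {u v} → Walk H u v 1 → Adj H u v
  walk-1 (cons e nil) = e

  walk? : ∀ k u v → Dec (Walk H u v k)
  walk? zero u v with u ≟ v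
  ... | yes refl = yes nil
  ... | no u≢v = no λ w → u≢v (walk-0 w)
  walk? (suc k) u v with any? (λ w → adj? H u w ×-dec walk? k w v)
  ... | yes (w , e , r) = yes (cons e r)
  ... | no none = no λ { (cons e r) → none (_ , e , r) }

  dist-exists : ∀ {u v k} → Walk H u v k → ∃ (Dist H u v)
  dist-exists {u} {v} = least-witness (λ j → walk? j u v)

  dist-unique : ∀ {u v a b} → Dist H u v a → Dist H u v b → a ≡ b
  dist-unique (wa , min-a) (wb , min-b) = ≤-antisym (min-a _ wb) (min-b _ wa)

  dist-refl : ∀ {u} → Dist H u u 0
  dist-refl = nil , λ _ _ → z≤n

  dist-adj : ∀ {u v} → u ≢ v → Adj H u v → Dist H u v 1
  dist-adj u≢v e = cons e nil , λ { zero w → ⊥-elim (u≢v (walk-0 w)) ; (suc j) _ → s≤s z≤n }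

  dist-two : ∀ {u v w} → u ≢ v → ¬ Adj H u v → Adj H u w → Adj H w v → Dist H u v 2
  dist-two {u} {v} u≢v ¬uv e₁ e₂ = cons e₁ (cons e₂ nil) , minimal
    where
    minimal : ∀ j → Walk H u v j → 2 ≤ j
    minimal zero w = ⊥-elim (u≢v (walk-0 w))
    minimal (suc zero) w = ⊥-elim (¬uv (walk-1 w))
    minimal (suc (suc j)) w = s≤s (s≤s z≤n)

dist-transfer≤ : ∀ {m m′} {H : Graph m} {H′ : Graph m′} {p q p′ q′} →
  (∀ j → Walk H p q j → Σ ℕ λ j′ → j′ ≤ j × Walk H′ p′ q′ j′) →
  (∀ j → Walk H′ p′ q′ j → Σ ℕ λ j′ → j′ ≤ j × Walk H p q j′) →
  ∀ {a} → Dist H p q a → Dist H′ p′ q′ a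
dist-transfer≤ {H′ = H′} {p′ = p′} {q′} forth back {a} (w , min) with forth a w
... | a′ , a′≤a , w′ = subst (Walk H′ p′ q′) (≤-antisym a′≤a (min′ a′ w′)) w′ , min′
  where
  min′ : ∀ j → Walk H′ p′ q′ j → a ≤ j
  min′ j w′ with back j w′
  ... | j″ , j″≤j , w″ = ≤-trans (min j″ w″) j″≤j

dist-transfer : ∀ {m m′} {H : Graph m} {H′ : Graph m′} {p q p′ q′} →
  (∀ {j} → Walk H p q j → Walk H′ p′ q′ j) →
  (∀ {j} → Walk H′ p′ q′ j → Walk H p q j) →
  ∀ {a} → Dist H p q a → Dist H′ p′ q′ a
dist-transfer forth back = dist-transfer≤ (λ j w → j , ≤-refl , forth w) (λ j w → j , ≤-refl , back w)

dist-sym : ∀ {m} {H : Graph m} {u v a} → Dist H u v a → Dist H v u a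
dist-sym = dist-transfer reverse reverse

-- Lines.  Betweenness and lines are defined from distances only, so any
-- vertex map that transports distances transports them.
module _ {m m′ k} {H : Graph m} {H′ : Graph m′} (f : Fin k → Fin m) (g : Fin k → Fin m′)
  (transport : ∀ {p q a} → Dist H (f p) (f q) a → Dist H′ (g p) (g q) a) where

  between-transfer : ∀ {u v z} → Between H (f u) (f v) (f z) → Between H′ (g u) (g v) (g z)
  between-transfer (a , b , c , duv , duz , dzv , e) =
    a , b , c , transport duv , transport duz , transport dzv , e

  online-transfer : ∀ {u v z} → OnLine H (f u) (f v) (f z) → OnLine H′ (g u) (g v) (g z)
  online-transfer (inj₁ β) = inj₁ (between-transfer β)
  online-transfer (inj₂ (inj₁ β)) = inj₂ (inj₁ (between-transfer β))
  online-transfer (inj₂ (inj₂ β)) = inj₂ (inj₂ (between-transfer β))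

module _ {m : ℕ} {H : Graph m} where

  online-swap : ∀ {u v z} → OnLine H u v z → OnLine H v u z
  online-swap (inj₁ (a , b , c , duv , duz , dzv , e)) =
    inj₁ (a , c , b , dist-sym duv , dist-sym dzv , dist-sym duz , trans e (+-comm b c))
  online-swap (inj₂ (inj₁ (a , b , c , duz , duv , dvz , e))) =
    inj₂ (inj₂ (a , c , b , dist-sym duz , dist-sym dvz , dist-sym duv , trans e (+-comm b c)))
  online-swap (inj₂ (inj₂ (a , b , c , dzv , dzu , duv , e))) =
    inj₂ (inj₁ (a , c , b , dist-sym dzv , dist-sym duv , dist-sym dzu , trans e (+-comm b c)))

  online-dist : ∀ {u v z} → OnLine H u v z → ∃ (Dist H u v)
  online-dist (inj₁ (a , _ , _ , duv , _)) = a , duv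
  online-dist (inj₂ (inj₁ (_ , b , _ , _ , duv , _))) = b , duv
  online-dist (inj₂ (inj₂ (_ , _ , c , _ , _ , duv , _))) = c , duv

  left-end-on-line : ∀ {u v a} → Dist H u v a → OnLine H u v u
  left-end-on-line {a = a} duv = inj₁ (a , 0 , a , duv , dist-refl , duv , refl)

  right-end-on-line : ∀ {u v a} → Dist H u v a → OnLine H u v v
  right-end-on-line {a = a} duv = inj₁ (a , a , 0 , duv , duv , dist-refl , ≡-sym (+-identityʳ a))

  common-neighbour-between : ∀ {u v w} → Dist H u v 2 → u ≢ w → w ≢ v →
    Adj H u w → Adj H w v → Between H u v w
  common-neighbour-between duv u≢w w≢v e₁ e₂ =
    2 , 1 , 1 , duv , dist-adj u≢w e₁ , dist-adj w≢v e₂ , refl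

  online-replace : ∀ {u v s t} →
    (∀ {a} → Dist H s u a → Dist H t u a) → (∀ {a} → Dist H s v a → Dist H t v a) →
    OnLine H u v s → OnLine H u v t
  online-replace at-u at-v (inj₁ (a , b , c , duv , dus , dsv , e)) =
    inj₁ (a , b , c , duv , dist-sym (at-u (dist-sym dus)) , at-v dsv , e)
  online-replace at-u at-v (inj₂ (inj₁ (a , b , c , dus , duv , dvs , e))) =
    inj₂ (inj₁ (a , b , c , dist-sym (at-u (dist-sym dus)) , duv , dist-sym (at-v (dist-sym dvs)) , e))
  online-replace at-u at-v (inj₂ (inj₂ (a , b , c , dsv , dsu , duv , e))) =
    inj₂ (inj₂ (a , b , c , at-v dsv , at-u dsu , duv , e))

  -- If q has the same distance to v as p, and d(p,q) > 0 is never 2·d(p,v),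
  -- then q is not on the line pv: each of the three betweenness equations
  -- would read D = d(p,q) + D or d(p,q) = D + D.
  equidistant-off-line : ∀ {p q v δ} → Dist H p q (suc δ) →
    (∀ {a} → Dist H p v a → Dist H q v a) →
    (∀ {D} → Dist H p v D → suc δ ≢ D + D) →
    ¬ OnLine H p v q
  equidistant-off-line dpq same no-half (inj₁ (a , b , c , dpv , dpq′ , dqv , e)) =
    m≢1+n+m a (trans e (cong₂ _+_ (dist-unique dpq′ dpq) (dist-unique dqv (same dpv))))
  equidistant-off-line dpq same no-half (inj₂ (inj₁ (a , b , c , dpq′ , dpv , dvq , e))) =
    no-half dpv (trans (dist-unique dpq dpq′)
                  (trans e (cong (b +_) (dist-unique (dist-sym dvq) (same dpv)))))
  equidistant-off-line dpq same no-half (inj₂ (inj₂ (a , b , c , dqv , dqp , dpv , e))) =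
    m≢1+n+m c (trans (dist-unique (same dpv) dqv)
                (trans e (cong (_+ c) (dist-unique (dist-sym dqp) dpq))))

IsModule : ∀ {m} → Graph m → (Fin m → Set) → Set
IsModule {m} H M = ∀ y → ¬ M y → (∀ {p} → M p → Adj H y p) ⊎ (∀ {p} → M p → ¬ Adj H y p)

module _ {m : ℕ} {H : Graph m} {M : Fin m → Set} (M? : ∀ y → Dec (M y))
  (module-M : IsModule H M) where

  -- a walk from M to an outside vertex can be restarted at any vertex of M:
  -- its first vertex outside M is adjacent to all of M
  restart-walk : ∀ {v p p′ j} → ¬ M v → M p → M p′ → Walk H p v j →
    Σ ℕ λ j′ → j′ ≤ j × Walk H p′ v j′
  restart-walk ¬Mv Mp Mp′ nil = ⊥-elim (¬Mv Mp)
  restart-walk ¬Mv Mp Mp′ (cons {w = w} e r) with M? w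
  ... | yes Mw with restart-walk ¬Mv Mw Mp′ r
  ...   | j′ , j′≤j , r′ = j′ , ≤-trans j′≤j (n≤1+n _) , r′
  restart-walk ¬Mv Mp Mp′ (cons {w = w} e r) | no ¬Mw with module-M w ¬Mw
  ...   | inj₁ adj-all = _ , ≤-refl , cons (sym H (adj-all Mp′)) r
  ...   | inj₂ adj-none = ⊥-elim (adj-none Mp (sym H e))

  module-dist : ∀ {v p p′ a} → ¬ M v → M p → M p′ → Dist H p v a → Dist H p′ v a
  module-dist ¬Mv Mp Mp′ =
    dist-transfer≤ (λ j → restart-walk ¬Mv Mp Mp′) (λ j → restart-walk ¬Mv Mp′ Mp)

FalseTwins : ∀ {m} → Graph m → Fin m → Fin m → Set
FalseTwins H s t = ∀ w → Adj H s w ⇔ Adj H t w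

module _ {m : ℕ} {H : Graph m} {s t : Fin m} (twins : FalseTwins H s t) where

  twins-sym : FalseTwins H t s
  twins-sym w = mk⇔ (Equivalence.from (twins w)) (Equivalence.to (twins w))

  twin-pair-module : IsModule H (λ w → w ≡ s ⊎ w ≡ t)
  twin-pair-module y _ with adj? H y s
  ... | yes e = inj₁ λ { (inj₁ refl) → e ; (inj₂ refl) → sym H (Equivalence.to (twins y) (sym H e)) }
  ... | no ¬e =
    inj₂ λ { (inj₁ refl) → ¬e ; (inj₂ refl) e → ¬e (sym H (Equivalence.from (twins y) (sym H e))) }

  twin-dist : ∀ {w a} → w ≢ s → w ≢ t → Dist H s w a → Dist H t w a
  twin-dist w≢s w≢t = module-dist (λ w → (w ≟ s) ⊎-dec (w ≟ t)) twin-pair-module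
    (λ { (inj₁ w≡s) → w≢s w≡s ; (inj₂ w≡t) → w≢t w≡t }) (inj₁ refl) (inj₂ refl)

  twin-on-line : ∀ {u v} → u ≢ s → u ≢ t → v ≢ s → v ≢ t → OnLine H u v s → OnLine H u v t
  twin-on-line u≢s u≢t v≢s v≢t = online-replace (twin-dist u≢s u≢t) (twin-dist v≢s v≢t)

  twin-off-line : ∀ {y} → Dist H s t 2 → y ≢ s → y ≢ t → ¬ Adj H s y → ¬ OnLine H s y t
  twin-off-line {y} dst y≢s y≢t ¬sy = equidistant-off-line dst (twin-dist y≢s y≢t) no-half
    where
    no-half : ∀ {D} → Dist H s y D → 2 ≢ D + D
    no-half {suc zero} (w , _) _ = ¬sy (walk-1 w)
    no-half {suc (suc (suc _))} _ ()
    no-half {suc (suc zero)} _ ()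
    no-half {zero} _ ()

-- Deleting one of two false twins gives an isometric subgraph: walks of H
-- through s are rerouted through t.  Hence lines of H - s are the traces of
-- lines of H.
module TwinDeletion {n : ℕ} (H : Graph (suc n)) {s t : Fin (suc n)}
  (s≢t : s ≢ t) (twins : FalseTwins H s t) where

  H′ : Graph n
  H′ = deleteVertex H s

  ι : Fin n → Fin (suc n)
  ι = punchIn s

  ρ : Fin (suc n) → Fin (suc n)
  ρ a with a ≟ s
  ... | yes _ = t
  ... | no _ = a

  ρ-avoids : ∀ a → s ≢ ρ a
  ρ-avoids a with a ≟ s
  ... | yes _ = s≢t
  ... | no a≢s = λ s≡a → a≢s (≡-sym s≡a)

  ρ-fixes : ∀ {a} → a ≢ s → ρ a ≡ a
  ρ-fixes {a} a≢s with a ≟ s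
  ... | yes a≡s = ⊥-elim (a≢s a≡s)
  ... | no _ = refl

  ρ-adj : ∀ {a b} → Adj H a b → Adj H (ρ a) (ρ b)
  ρ-adj {a} {b} e with a ≟ s | b ≟ s
  ... | yes refl | yes refl = ⊥-elim (irrefl H e)
  ... | yes refl | no _ = Equivalence.to (twins b) e
  ... | no _ | yes refl = sym H (Equivalence.to (twins a) (sym H e))
  ... | no _ | no _ = e

  ψ : Fin (suc n) → Fin n
  ψ a = punchOut (ρ-avoids a)

  ιψ : ∀ a → ι (ψ a) ≡ ρ a
  ιψ a = punchIn-punchOut (ρ-avoids a)

  ψι : ∀ p → ψ (ι p) ≡ p
  ψι p = punchIn-injective s _ _ (trans (ιψ (ι p)) (ρ-fixes (punchInᵢ≢i s p)))

  lift-walk : ∀ {p q k} → Walk H′ p q k → Walk H (ι p) (ι q) k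
  lift-walk nil = nil
  lift-walk (cons e r) = cons e (lift-walk r)

  retract-walk : ∀ {a b k} → Walk H a b k → Walk H′ (ψ a) (ψ b) k
  retract-walk nil = nil
  retract-walk (cons {u} {w} e r) =
    cons (subst₂ (Adj H) (≡-sym (ιψ u)) (≡-sym (ιψ w)) (ρ-adj e)) (retract-walk r)

  lower-walk : ∀ {p q k} → Walk H (ι p) (ι q) k → Walk H′ p q k
  lower-walk {p} {q} {k} w = subst₂ (λ a b → Walk H′ a b k) (ψι p) (ψι q) (retract-walk w)

  dist-lift : ∀ {p q a} → Dist H′ p q a → Dist H (ι p) (ι q) a
  dist-lift = dist-transfer lift-walk lower-walk

  dist-lower : ∀ {p q a} → Dist H (ι p) (ι q) a → Dist H′ p q a
  dist-lower = dist-transfer lower-walk lift-walk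

  online-lift : ∀ {u v z} → OnLine H′ u v z → OnLine H (ι u) (ι v) (ι z)
  online-lift = online-transfer (λ p → p) ι dist-lift

  online-lower : ∀ {u v z} → OnLine H (ι u) (ι v) (ι z) → OnLine H′ u v z
  online-lower = online-transfer ι (λ p → p) dist-lower

  sameline-lower : ∀ {u v u′ v′} →
    SameLine H (ι u , ι v) (ι u′ , ι v′) → SameLine H′ (u , v) (u′ , v′)
  sameline-lower same z = mk⇔
    (λ o → online-lower (Equivalence.to (same (ι z)) (online-lift o)))
    (λ o → online-lower (Equivalence.from (same (ι z)) (online-lift o)))

  ι-onto : ∀ z → z ≢ s → ι (ψ z) ≡ z
  ι-onto z z≢s = trans (ιψ z) (ρ-fixes z≢s)

SpanningPair : ∀ {m} → Graph m → Set
SpanningPair {m} H = Σ (Fin m) λ u → Σ (Fin m) λ v → u ≢ v ×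
  (Σ ℕ λ k → k ≤ 2 × Dist H u v k) × (∀ z → OnLine H u v z)

ManyLines : ∀ {m} → Graph m → Set
ManyLines {m} H = Σ (Fin m → Fin m × Fin m) λ f →
  (∀ i → proj₁ (f i) ≢ proj₂ (f i)) × (∀ i j → i ≢ j → ¬ SameLine H (f i) (f j))

module FourCycle {n : ℕ} (G : Graph (suc n)) (x0 x1 x2 x3 : Fin (suc n))
  (connected : Connected G) (c4 : InducedC4 G x0 x1 x2 x3) (module4 : IsModule4 G x0 x1 x2 x3) where

  x0≢x1 : x0 ≢ x1
  x0≢x1 = proj₁ (proj₁ c4)
  x0≢x2 : x0 ≢ x2
  x0≢x2 = proj₁ (proj₂ (proj₁ c4))
  x0≢x3 : x0 ≢ x3
  x0≢x3 = proj₁ (proj₂ (proj₂ (proj₁ c4)))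
  x1≢x2 : x1 ≢ x2
  x1≢x2 = proj₁ (proj₂ (proj₂ (proj₂ (proj₁ c4))))
  x1≢x3 : x1 ≢ x3
  x1≢x3 = proj₁ (proj₂ (proj₂ (proj₂ (proj₂ (proj₁ c4)))))
  x2≢x3 : x2 ≢ x3
  x2≢x3 = proj₂ (proj₂ (proj₂ (proj₂ (proj₂ (proj₁ c4)))))
  x0x1 : Adj G x0 x1
  x0x1 = proj₁ (proj₁ (proj₂ c4))
  x1x2 : Adj G x1 x2
  x1x2 = proj₁ (proj₂ (proj₁ (proj₂ c4)))
  x2x3 : Adj G x2 x3
  x2x3 = proj₁ (proj₂ (proj₂ (proj₁ (proj₂ c4))))
  x3x0 : Adj G x3 x0
  x3x0 = proj₂ (proj₂ (proj₂ (proj₁ (proj₂ c4))))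
  ¬x0x2 : ¬ Adj G x0 x2
  ¬x0x2 = proj₁ (proj₂ (proj₂ c4))
  ¬x1x3 : ¬ Adj G x1 x3
  ¬x1x3 = proj₂ (proj₂ (proj₂ c4))

  ≢-sym : ∀ {a b : Fin (suc n)} → a ≢ b → b ≢ a
  ≢-sym a≢b b≡a = a≢b (≡-sym b≡a)

  M : Fin (suc n) → Set
  M y = y ≡ x0 ⊎ y ≡ x1 ⊎ y ≡ x2 ⊎ y ≡ x3

  M? : ∀ y → Dec (M y)
  M? y = (y ≟ x0) ⊎-dec (y ≟ x1) ⊎-dec (y ≟ x2) ⊎-dec (y ≟ x3)

  ¬M : ∀ {y} → y ≢ x0 → y ≢ x1 → y ≢ x2 → y ≢ x3 → ¬ M y
  ¬M h0 h1 h2 h3 (inj₁ e) = h0 e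
  ¬M h0 h1 h2 h3 (inj₂ (inj₁ e)) = h1 e
  ¬M h0 h1 h2 h3 (inj₂ (inj₂ (inj₁ e))) = h2 e
  ¬M h0 h1 h2 h3 (inj₂ (inj₂ (inj₂ e))) = h3 e

  module-M : IsModule G M
  module-M y ¬My
    with module4 y (λ e → ¬My (inj₁ e)) (λ e → ¬My (inj₂ (inj₁ e)))
                   (λ e → ¬My (inj₂ (inj₂ (inj₁ e)))) (λ e → ¬My (inj₂ (inj₂ (inj₂ e))))
  ... | inj₁ (b0 , b1 , b2 , b3) =
    inj₁ λ { (inj₁ refl) → b0 ; (inj₂ (inj₁ refl)) → b1
           ; (inj₂ (inj₂ (inj₁ refl))) → b2 ; (inj₂ (inj₂ (inj₂ refl))) → b3 }
  ... | inj₂ (c0 , c1 , c2 , c3) =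
    inj₂ λ { (inj₁ refl) → c0 ; (inj₂ (inj₁ refl)) → c1
           ; (inj₂ (inj₂ (inj₁ refl))) → c2 ; (inj₂ (inj₂ (inj₂ refl))) → c3 }

  -- x0 and x2 are false twins: inside M both see exactly x1 and x3,
  -- and outside M the module property applies
  x0-x2-twins : FalseTwins G x0 x2
  x0-x2-twins w = mk⇔ (to w) (from w)
    where
    same-outside : ∀ {w p q} → ¬ M w → M p → M q → Adj G p w → Adj G q w
    same-outside {w} ¬Mw Mp Mq e with module-M w ¬Mw
    ... | inj₁ adj-all = sym G (adj-all Mq)
    ... | inj₂ adj-none = ⊥-elim (adj-none Mp (sym G e))
    to : ∀ w → Adj G x0 w → Adj G x2 w
    to w e with M? w
    ... | yes (inj₁ refl) = ⊥-elim (irrefl G e)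
    ... | yes (inj₂ (inj₁ refl)) = sym G x1x2
    ... | yes (inj₂ (inj₂ (inj₁ refl))) = ⊥-elim (¬x0x2 e)
    ... | yes (inj₂ (inj₂ (inj₂ refl))) = x2x3
    ... | no ¬Mw = same-outside ¬Mw (inj₁ refl) (inj₂ (inj₂ (inj₁ refl))) e
    from : ∀ w → Adj G x2 w → Adj G x0 w
    from w e with M? w
    ... | yes (inj₁ refl) = ⊥-elim (¬x0x2 (sym G e))
    ... | yes (inj₂ (inj₁ refl)) = x0x1
    ... | yes (inj₂ (inj₂ (inj₁ refl))) = ⊥-elim (irrefl G e)
    ... | yes (inj₂ (inj₂ (inj₂ refl))) = sym G x3x0
    ... | no ¬Mw = same-outside ¬Mw (inj₂ (inj₂ (inj₁ refl))) (inj₁ refl) e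

  d02 : Dist G x0 x2 2
  d02 = dist-two x0≢x2 ¬x0x2 x0x1 x1x2

  d13 : Dist G x1 x3 2
  d13 = dist-two x1≢x3 ¬x1x3 (sym G x0x1) (sym G x3x0)

  open TwinDeletion G x0≢x2 x0-x2-twins

  -- Either v ∈ {x1, x3} is a common neighbour of x2 and x0, or v ∉ M and
  -- then x1, a neighbour of x2 equidistant from v, cannot lie on x2 v.
  x0-on-line-from-x2 : ∀ {v} → v ≢ x0 → v ≢ x2 →
    (∀ z → z ≢ x0 → OnLine G x2 v z) → OnLine G x2 v x0
  x0-on-line-from-x2 {v} v≢x0 v≢x2 spans with v ≟ x1 | v ≟ x3
  ... | yes refl | _ = inj₂ (inj₁ (common-neighbour-between (dist-sym d02)
                         (≢-sym x1≢x2) (≢-sym x0≢x1) (sym G x1x2) (sym G x0x1)))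
  ... | no _ | yes refl = inj₂ (inj₁ (common-neighbour-between (dist-sym d02)
                             x2≢x3 (≢-sym x0≢x3) x2x3 x3x0))
  ... | no v≢x1 | no v≢x3 =
    ⊥-elim (equidistant-off-line (dist-adj (≢-sym x1≢x2) (sym G x1x2))
              (module-dist M? module-M ¬Mv (inj₂ (inj₂ (inj₁ refl))) (inj₂ (inj₁ refl)))
              (λ {D} _ → one≢double D)
              (spans x1 (≢-sym x0≢x1)))
    where
    ¬Mv : ¬ M v
    ¬Mv = ¬M v≢x0 v≢x1 v≢x2 v≢x3
    one≢double : ∀ D → 1 ≢ D + D
    one≢double zero ()
    one≢double (suc D) e with trans e (cong suc (+-suc D D))
    ... | ()

  x0-on-spanning-line : ∀ {u v} → u ≢ x0 → v ≢ x0 → u ≢ v →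
    (∀ z → z ≢ x0 → OnLine G u v z) → OnLine G u v x0
  x0-on-spanning-line {u} {v} u≢x0 v≢x0 u≢v spans with u ≟ x2 | v ≟ x2
  ... | yes refl | _ = x0-on-line-from-x2 v≢x0 (≢-sym u≢v) spans
  ... | no _ | yes refl =
    online-swap (x0-on-line-from-x2 u≢x0 u≢v (λ z z≢x0 → online-swap (spans z z≢x0)))
  ... | no u≢x2 | no v≢x2 =
    twin-on-line (twins-sym {H = G} x0-x2-twins) u≢x2 u≢x0 v≢x2 v≢x0 (spans x2 (≢-sym x0≢x2))

  lift-spanning-pair : SpanningPair H′ → SpanningPair G
  lift-spanning-pair (a , b , a≢b , (k , k≤2 , dab) , spans) =
    ι a , ι b , ιa≢ιb , (k , k≤2 , dist-lift dab) , λ z → on-line z (z ≟ x0)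
    where
    ιa≢ιb : ι a ≢ ι b
    ιa≢ιb e = a≢b (punchIn-injective x0 a b e)
    spans′ : ∀ z → z ≢ x0 → OnLine G (ι a) (ι b) z
    spans′ z z≢x0 = subst (OnLine G (ι a) (ι b)) (ι-onto z z≢x0) (online-lift (spans (ψ z)))
    on-line : ∀ z → Dec (z ≡ x0) → OnLine G (ι a) (ι b) z
    on-line z (no z≢x0) = spans′ z z≢x0
    on-line z (yes refl) = x0-on-spanning-line (punchInᵢ≢i x0 a) (punchInᵢ≢i x0 b) ιa≢ιb spans′

  x2-on-line-through-x0 : ∀ {u v} → u ≢ x0 → v ≢ x0 → OnLine G u v x0 → OnLine G u v x2
  x2-on-line-through-x0 {u} {v} u≢x0 v≢x0 on with u ≟ x2 | v ≟ x2
  ... | yes refl | _ = left-end-on-line (proj₂ (online-dist on))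
  ... | no _ | yes refl = right-end-on-line (proj₂ (online-dist on))
  ... | no u≢x2 | no v≢x2 = twin-on-line x0-x2-twins u≢x0 u≢x2 v≢x0 v≢x2 on

  Far : Fin (suc n) → Set
  Far y = y ≢ x0 × y ≢ x2 × ¬ Adj G x0 y

  far? : ∀ y → Dec (Far y)
  far? y = ¬? (y ≟ x0) ×-dec ¬? (y ≟ x2) ×-dec ¬? (adj? G x0 y)

  -- If x0 is adjacent to every vertex other than x0, x2, then every vertex
  -- other than x1, x3 is a common neighbour of x1 and x3, so x1 x3 spans G.
  no-far-spanning-pair : ¬ ∃ Far → SpanningPair G
  no-far-spanning-pair no-far = x1 , x3 , x1≢x3 , (2 , s≤s (s≤s z≤n) , d13) , on-line
    where
    between : ∀ {z} → x1 ≢ z → z ≢ x3 → Adj G x1 z → Adj G z x3 → OnLine G x1 x3 z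
    between x1≢z z≢x3 e₁ e₂ = inj₁ (common-neighbour-between d13 x1≢z z≢x3 e₁ e₂)
    on-line : ∀ z → OnLine G x1 x3 z
    on-line z with M? z
    ... | yes (inj₁ refl) = between (≢-sym x0≢x1) x0≢x3 (sym G x0x1) (sym G x3x0)
    ... | yes (inj₂ (inj₁ refl)) = left-end-on-line d13
    ... | yes (inj₂ (inj₂ (inj₁ refl))) = between x1≢x2 x2≢x3 x1x2 x2x3
    ... | yes (inj₂ (inj₂ (inj₂ refl))) = right-end-on-line d13
    ... | no ¬Mz with module-M z ¬Mz
    ...   | inj₁ adj-all =
      between (λ e → ¬Mz (inj₂ (inj₁ (≡-sym e)))) (λ e → ¬Mz (inj₂ (inj₂ (inj₂ e))))
              (sym G (adj-all (inj₂ (inj₁ refl)))) (adj-all (inj₂ (inj₂ (inj₂ refl))))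
    ...   | inj₂ adj-none = ⊥-elim (no-far (z , z≢x0 , z≢x2 , λ e → adj-none (inj₁ refl) (sym G e)))
      where
      z≢x0 : z ≢ x0
      z≢x0 e = ¬Mz (inj₁ e)
      z≢x2 : z ≢ x2
      z≢x2 e = ¬Mz (inj₂ (inj₂ (inj₁ e)))

  -- For a far vertex y the line x0 y contains x0 but not x2, so it differs
  -- from every lifted line; adding it to the lifted lines of G - x0 gives
  -- one more distinct line.
  far-extends-lines : ∀ {y} → Far y → ManyLines H′ → ManyLines G
  far-extends-lines {y} (y≢x0 , y≢x2 , ¬x0y) (f′ , distinct′ , different′) = f , distinct , different
    where
    d0y : Dist G x0 y (proj₁ (dist-exists (proj₂ (connected x0 y))))
    d0y = proj₂ (dist-exists (proj₂ (connected x0 y)))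
    f : Fin (suc n) → Fin (suc n) × Fin (suc n)
    f fzero = x0 , y
    f (fsuc i) = ι (proj₁ (f′ i)) , ι (proj₂ (f′ i))
    distinct : ∀ i → proj₁ (f i) ≢ proj₂ (f i)
    distinct fzero e = y≢x0 (≡-sym e)
    distinct (fsuc i) e = distinct′ i (punchIn-injective x0 _ _ e)
    new-line : ∀ {u v} → u ≢ x0 → v ≢ x0 → ¬ SameLine G (x0 , y) (u , v)
    new-line u≢x0 v≢x0 same =
      twin-off-line x0-x2-twins d02 y≢x0 y≢x2 ¬x0y
        (Equivalence.from (same x2)
          (x2-on-line-through-x0 u≢x0 v≢x0 (Equivalence.to (same x0) (left-end-on-line d0y))))
    flip : ∀ {P Q} → SameLine G P Q → SameLine G Q P
    flip same z = mk⇔ (Equivalence.from (same z)) (Equivalence.to (same z))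
    different : ∀ i j → i ≢ j → ¬ SameLine G (f i) (f j)
    different fzero fzero i≢j _ = i≢j refl
    different fzero (fsuc j) _ = new-line (punchInᵢ≢i x0 _) (punchInᵢ≢i x0 _)
    different (fsuc i) fzero _ same = new-line (punchInᵢ≢i x0 _) (punchInᵢ≢i x0 _) (flip same)
    different (fsuc i) (fsuc j) i≢j same = different′ i j (λ e → i≢j (cong fsuc e)) (sameline-lower same)

proposition5 : ∀ {n} (G : Graph (suc n)) (x0 x1 x2 x3 : Fin (suc n)) →
    Connected G → InducedC4 G x0 x1 x2 x3 → IsModule4 G x0 x1 x2 x3 →
    PropertyP (deleteVertex G x0) → PropertyP G
proposition5 G x0 x1 x2 x3 connected c4 module4 = conclude
  where
  open FourCycle G x0 x1 x2 x3 connected c4 module4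
  conclude : SpanningPair (deleteVertex G x0) ⊎ ManyLines (deleteVertex G x0) → SpanningPair G ⊎ ManyLines G
  conclude (inj₁ pair) = inj₁ (lift-spanning-pair pair)
  conclude (inj₂ lines) with any? far?
  ... | yes (y , far) = inj₂ (far-extends-lines far lines)
  ... | no no-far = inj₁ (no-far-spanning-pair no-far)
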